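{- Let $K\leq N$ be positive integers. Then \[\#\Big\{1\leq B\leq N:\ \prod_{p^3\mid B} p^{v_p(B)}\geq K \Big\}\ll NK^{ -\frac{2}{5}},\] with an absolute implied constant.
   Context: The product is over primes $p$ with $p^3\mid B$, and $v_p$ is the $p$-adic valuation. -}

module Defs where

open import Data.Nat using (ℕ; zero; suc; _*_; _^_; _≤?_)
open import Data.Nat.Divisibility using (_∣?_)
open import Data.Nat.Primality using (prime?)
open import Data.List using (List; []; _∷_; filter; length; map)
open import Data.Nat.ListAction using (product)
open import Data.List.Base using (upTo)
open import Relation.Nullary.Decidable using (does; _×-dec_)
open import Data.Bool using (if_then_else_)

range1 : ℕ → List ℕ
range1 n = map suc (upTo n)

-- p-adic valuation v_p(B) for B ≥ 1, p ≥ 2: the largest k ≤ B with p^k ∣ B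
-- (v_p(B) ≤ B always holds for B ≥ 1, p ≥ 2).
-- valAux p B k = largest j ≤ k with p^j ∣ B (0 if none besides j = 0).
valAux : ℕ → ℕ → ℕ → ℕ
valAux p B zero = zero
valAux p B (suc k) = if does ((p ^ suc k) ∣? B) then suc k else valAux p B k

v : ℕ → ℕ → ℕ
v p B = valAux p B B

-- cube-full part of B: ∏_{p prime, p^3 ∣ B} p^{v_p(B)}
-- (all primes dividing B ≥ 1 are ≤ B, so ranging over p ∈ [1..B] suffices)
cubefullPart : ℕ → ℕ
cubefullPart B =
  product (map (λ p → p ^ v p B)
    (filter (λ p → prime? p ×-dec ((p ^ 3) ∣? B)) (range1 B)))

countLarge : ℕ → ℕ → ℕ
countLarge K N = length (filter (λ B → K ≤? cubefullPart B) (range1 N))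

-- Let m(B) be the largest m with m³ ∣ B, i.e. ∏_{p³ ∣ B} p^⌊v_p(B)/3⌋. Since v ≤ 5⌊v/3⌋ for
-- v ≥ 3, the cube-full part of B is at most m(B)⁵, so cube-full part ≥ K forces m(B) ≥ M, the
-- least M with K ≤ M⁵. Hence the count is at most Σ_{m ≥ M} ⌊N/m³⌋ ≤ 4N/M², and raising
-- count · M² ≤ 4N to the fifth power and using K ≤ M⁵ gives count⁵ K² ≤ 4⁵ N⁵.
module Submission where

open import Defs
open import Data.Nat using (ℕ; zero; suc; _+_; _*_; _^_; _∸_; _≤_; _<_; _≤?_; _<?_; z≤n; s≤s; NonZero; nonTrivial⇒n>1; nonTrivial⇒≢1)
open import Data.Nat.Properties
open import Data.Nat.Divisibility
open import Data.Nat.DivMod using (_/_; _%_; m≡m%n+[m/n]*n; m%n<n; m/n*n≤m; m≥n⇒m/n>0)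
open import Data.Nat.Primality using (Prime; prime?; euclidsLemma; prime⇒irreducible; prime⇒nonZero; prime⇒nonTrivial)
open import Data.Nat.ListAction using (sum; product)
open import Data.Nat.Tactic.RingSolver using (solve-∀)
open import Data.List using (List; []; _∷_; [_]; _++_; filter; length; map; upTo)
open import Data.List.Properties using (upTo-∷ʳ; map-++; map-cong; filter-++; length-++)
open import Data.List.Membership.Propositional using (_∈_)
open import Data.List.Membership.Propositional.Properties using (∈-map⁻; ∈-upTo⁻)
open import Data.List.Relation.Unary.All as All using (All; []; _∷_)
open import Data.List.Relation.Unary.All.Properties using (all-filter)
open import Data.List.Relation.Unary.Any using (here; there)
open import Data.List.Relation.Unary.AllPairs using (_∷_)
open import Data.List.Relation.Unary.Unique.Propositional using (Unique)
open import Data.List.Relation.Unary.Unique.Propositional.Properties using (filter⁺; map⁺; upTo⁺)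
open import Data.Product using (∃; ∃-syntax; _×_; _,_; proj₁)
open import Data.Sum using (inj₁; inj₂)
open import Relation.Binary.PropositionalEquality using (_≡_; _≢_; refl; sym; trans; cong; subst; module ≡-Reasoning)
open import Function using (_∘_)
open import Relation.Nullary using (¬_; yes; no; contradiction)
open import Relation.Nullary.Decidable using (_×-dec_)
open import Relation.Unary using (Pred; Decidable)
open import Level using (0ℓ)

^-distribʳ-* : ∀ m n o → (m * n) ^ o ≡ m ^ o * n ^ o
^-distribʳ-* m n zero    = refl
^-distribʳ-* m n (suc o) = trans (cong (m * n *_) (^-distribʳ-* m n o)) (interchange m n (m ^ o) (n ^ o))
  where
  interchange : ∀ a b c d → a * b * (c * d) ≡ a * c * (b * d)
  interchange = solve-∀

m≤[m/3]*5 : ∀ m → 3 ≤ m → m ≤ m / 3 * 5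
m≤[m/3]*5 m 3≤m = begin
  m                     ≡⟨ m≡m%n+[m/n]*n m 3 ⟩
  m % 3 + q * 3         ≤⟨ +-monoˡ-≤ (q * 3) (≤-pred (m%n<n m 3)) ⟩
  2 + q * 3             ≤⟨ +-monoˡ-≤ (q * 3) (*-monoʳ-≤ 2 (m≥n⇒m/n>0 3≤m)) ⟩
  2 * q + q * 3         ≡⟨ regroup q ⟩
  q * 5                 ∎
  where
  open ≤-Reasoning
  q = m / 3
  regroup : ∀ q → 2 * q + q * 3 ≡ q * 5
  regroup = solve-∀

least-root : ∀ e .{{_ : NonZero e}} K → ∃[ M ] K ≤ M ^ e × (∀ m → K ≤ m ^ e → M ≤ m)
least-root e zero    = 0 , z≤n , λ _ _ → z≤n
least-root e (suc K) with least-root e K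
... | M , K≤M^e , least with suc K ≤? M ^ e
...   | yes K<M^e = M , K<M^e , λ m K<m^e → least m (≤-trans (n≤1+n K) K<m^e)
...   | no  K≮M^e = suc M , ≤-trans (s≤s (≤-reflexive (sym M^e≡K))) (^-monoˡ-< e (n<1+n M)) , least′
  where
  M^e≡K : M ^ e ≡ K
  M^e≡K = ≤-antisym (≤-pred (≰⇒> K≮M^e)) K≤M^e
  least′ : ∀ m → suc K ≤ m ^ e → suc M ≤ m
  least′ m K<m^e with M <? m
  ... | yes M<m = M<m
  ... | no  M≮m = contradiction (≤-trans K<m^e (≤-trans (^-monoˡ-≤ e (≮⇒≥ M≮m)) (≤-reflexive M^e≡K))) 1+n≰n

product-map-^ : ∀ (f : ℕ → ℕ) xs n → product (map f xs) ^ n ≡ product (map (λ x → f x ^ n) xs)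
product-map-^ f []       n = ^-zeroˡ n
product-map-^ f (x ∷ xs) n =
  trans (^-distribʳ-* (f x) (product (map f xs)) n) (cong (f x ^ n *_) (product-map-^ f xs n))

product-map-mono-≤ : ∀ {P : Pred ℕ 0ℓ} (f g : ℕ → ℕ) {xs} → All P xs →
                     (∀ {x} → P x → f x ≤ g x) → product (map f xs) ≤ product (map g xs)
product-map-mono-≤ f g []         f≤g = ≤-refl
product-map-mono-≤ f g (px ∷ pxs) f≤g = *-mono-≤ (f≤g px) (product-map-mono-≤ f g pxs f≤g)

^-monoʳ-∣ : ∀ m {a b} → a ≤ b → m ^ a ∣ m ^ b
^-monoʳ-∣ m {a} {b} a≤b = divides (m ^ (b ∸ a)) (begin
  m ^ b             ≡⟨ cong (m ^_) (m+[n∸m]≡n a≤b) ⟨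
  m ^ (a + (b ∸ a)) ≡⟨ ^-distribˡ-+-* m a (b ∸ a) ⟩
  m ^ a * m ^ (b ∸ a) ≡⟨ *-comm (m ^ a) _ ⟩
  m ^ (b ∸ a) * m ^ a ∎)
  where open ≡-Reasoning

prime≢1 : ∀ {p} → Prime p → p ≢ 1
prime≢1 pp = nonTrivial⇒≢1 {{prime⇒nonTrivial pp}}

prime∣prime^⇒≡ : ∀ {p q} → Prime p → Prime q → ∀ n → p ∣ q ^ n → p ≡ q
prime∣prime^⇒≡ pp pq zero    p∣1 = contradiction (∣1⇒≡1 p∣1) (prime≢1 pp)
prime∣prime^⇒≡ pp pq (suc n) p∣q^[1+n] with euclidsLemma _ _ pp p∣q^[1+n]
... | inj₂ p∣q^n = prime∣prime^⇒≡ pp pq n p∣q^n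
... | inj₁ p∣q   with prime⇒irreducible pq p∣q
...   | inj₁ p≡1 = contradiction p≡1 (prime≢1 pp)
...   | inj₂ p≡q = p≡q

prime^∣m*n⇒∣m : ∀ {p n} → Prime p → ¬ p ∣ n → ∀ e m → p ^ e ∣ m * n → p ^ e ∣ m
prime^∣m*n⇒∣m pp p∤n zero    m _ = 1∣ _
prime^∣m*n⇒∣m {p} {n} pp p∤n (suc e) m p^[1+e]∣mn
  with euclidsLemma m n pp (∣-trans (m∣m*n (p ^ e)) p^[1+e]∣mn)
... | inj₂ p∣n = contradiction p∣n p∤n
... | inj₁ (divides m′ refl) =
  subst (p ^ suc e ∣_) (*-comm p m′) (*-monoʳ-∣ p (prime^∣m*n⇒∣m pp p∤n e m′ p^e∣m′n))
  where
  instance _ = prime⇒nonZero pp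
  p^e∣m′n : p ^ e ∣ m′ * n
  p^e∣m′n = *-cancelˡ-∣ p (subst (p ^ suc e ∣_) (rearrange m′ p n) p^[1+e]∣mn)
    where
    rearrange : ∀ a b c → a * b * c ≡ b * (a * c)
    rearrange = solve-∀

module _ (n : ℕ) (e : ℕ → ℕ) where

  primePowers : List ℕ → ℕ
  primePowers ps = product (map (λ p → p ^ e p) ps)

  PrimePowerDivisor : Pred ℕ 0ℓ
  PrimePowerDivisor p = Prime p × p ^ e p ∣ n

  prime∤primePowers : ∀ {p qs} → Prime p → All Prime qs → All (p ≢_) qs → ¬ p ∣ primePowers qs
  prime∤primePowers pp []         []           p∣1 = contradiction (∣1⇒≡1 p∣1) (prime≢1 pp)
  prime∤primePowers {qs = q ∷ qs} pp (pq ∷ pqs) (p≢q ∷ p≢qs) p∣∏ with euclidsLemma (q ^ e q) (primePowers qs) pp p∣∏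
  ... | inj₁ p∣q^e = p≢q (prime∣prime^⇒≡ pp pq (e q) p∣q^e)
  ... | inj₂ p∣∏qs = prime∤primePowers pp pqs p≢qs p∣∏qs

  primePowers-∣ : ∀ {ps} → Unique ps → All PrimePowerDivisor ps → primePowers ps ∣ n
  primePowers-∣ {[]}     _             _ = 1∣ n
  primePowers-∣ {p ∷ ps} (p≢ps ∷ uniq) ((pp , p^e∣n) ∷ divs) with primePowers-∣ uniq divs
  ... | divides c n≡c*∏ = subst (primePowers (p ∷ ps) ∣_) (sym n≡c*∏)
    (*-monoˡ-∣ (primePowers ps)
      (prime^∣m*n⇒∣m pp (prime∤primePowers pp (All.map proj₁ divs) p≢ps) (e p) c
        (subst (p ^ e p ∣_) n≡c*∏ p^e∣n)))

count : ∀ {A : Set} {P : Pred A 0ℓ} → Decidable P → List A → ℕ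
count P? xs = length (filter P? xs)

count-++ : ∀ {A : Set} {P : Pred A 0ℓ} (P? : Decidable P) xs ys → count P? (xs ++ ys) ≡ count P? xs + count P? ys
count-++ P? xs ys = trans (cong length (filter-++ P? xs ys)) (length-++ (filter P? xs))

count-singleton : ∀ {A : Set} {P : Pred A 0ℓ} (P? : Decidable P) {x} → P x → 1 ≤ count P? [ x ]
count-singleton P? {x} px with P? x
... | yes _  = ≤-refl
... | no ¬px = contradiction px ¬px

sum-map-+ : ∀ {A : Set} (f g : A → ℕ) xs → sum (map (λ x → f x + g x) xs) ≡ sum (map f xs) + sum (map g xs)
sum-map-+ f g []       = refl
sum-map-+ f g (x ∷ xs) = trans (cong (f x + g x +_) (sum-map-+ f g xs)) (interchange (f x) (g x) _ _)
  where
  interchange : ∀ a b c d → a + b + (c + d) ≡ a + c + (b + d)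
  interchange = solve-∀

∈⇒≤sum : ∀ {A : Set} (f : A → ℕ) {x xs} → x ∈ xs → f x ≤ sum (map f xs)
∈⇒≤sum f (here refl) = m≤m+n _ _
∈⇒≤sum f {xs = y ∷ _} (there x∈xs) = ≤-trans (∈⇒≤sum f x∈xs) (m≤n+m _ (f y))

count≤sum-count : ∀ {A I : Set} {P : Pred A 0ℓ} {Q : I → Pred A 0ℓ} (P? : Decidable P) (Q? : ∀ i → Decidable (Q i))
                  is xs → (∀ {x} → x ∈ xs → P x → ∃[ i ] i ∈ is × Q i x) →
                  count P? xs ≤ sum (map (λ i → count (Q? i) xs) is)
count≤sum-count P? Q? is []       _     = z≤n
count≤sum-count P? Q? is (x ∷ xs) cover = begin
  count P? (x ∷ xs)                                       ≡⟨ count-++ P? [ x ] xs ⟩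
  count P? [ x ] + count P? xs                            ≤⟨ +-mono-≤ covered (count≤sum-count P? Q? is xs (cover ∘ there)) ⟩
  sum (map (λ i → count (Q? i) [ x ]) is) + sum (map (λ i → count (Q? i) xs) is)
                                                          ≡⟨ sum-map-+ _ _ is ⟨
  sum (map (λ i → count (Q? i) [ x ] + count (Q? i) xs) is) ≡⟨ cong sum (map-cong (λ i → count-++ (Q? i) [ x ] xs) is) ⟨
  sum (map (λ i → count (Q? i) (x ∷ xs)) is)              ∎
  where
  open ≤-Reasoning
  covered : count P? [ x ] ≤ sum (map (λ i → count (Q? i) [ x ]) is)
  covered with P? x
  ... | no  _  = z≤n
  ... | yes px with i , i∈is , qix ← cover (here refl) px =
    ≤-trans (count-singleton (Q? i) qix) (∈⇒≤sum (λ i → count (Q? i) [ x ]) i∈is)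

range1-suc : ∀ n → range1 (suc n) ≡ range1 n ++ [ suc n ]
range1-suc n = trans (cong (map suc) (sym (upTo-∷ʳ n))) (map-++ suc (upTo n) [ n ])

count-multiples : ∀ d .{{_ : NonZero d}} n → count (d ∣?_) (range1 n) * d ≤ n
count-multiples d zero    = z≤n
count-multiples d (suc n) = begin
  count (d ∣?_) (range1 (suc n)) * d                           ≡⟨ cong (λ xs → count (d ∣?_) xs * d) (range1-suc n) ⟩
  count (d ∣?_) (range1 n ++ [ suc n ]) * d                    ≡⟨ cong (_* d) (count-++ (d ∣?_) (range1 n) [ suc n ]) ⟩
  (count (d ∣?_) (range1 n) + count (d ∣?_) [ suc n ]) * d     ≤⟨ add-last (count (d ∣?_) (range1 n)) (count-multiples d n) ⟩
  suc n                                                        ∎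
  where
  open ≤-Reasoning
  add-last : ∀ c → c * d ≤ n → (c + count (d ∣?_) [ suc n ]) * d ≤ suc n
  add-last c c*d≤n with d ∣? suc n
  ... | no  _ = ≤-trans (≤-reflexive (cong (_* d) (+-identityʳ c))) (m≤n⇒m≤1+n c*d≤n)
  ... | yes (divides q 1+n≡q*d) = begin
    (c + 1) * d ≡⟨ cong (_* d) (+-comm c 1) ⟩
    suc c * d   ≤⟨ *-monoˡ-≤ d (*-cancelʳ-< d c q (≤-trans (s≤s c*d≤n) (≤-reflexive 1+n≡q*d))) ⟩
    q * d       ≡⟨ 1+n≡q*d ⟨
    suc n       ∎

interval : ℕ → ℕ → List ℕ
interval M zero    = []
interval M (suc j) = M ∷ interval (suc M) j

∈-interval⁺ : ∀ {m} M j → M ≤ m → m < M + j → m ∈ interval M j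
∈-interval⁺ M zero    M≤m m<M+0 = contradiction (≤-trans m<M+0 (≤-reflexive (+-identityʳ M))) (≤⇒≯ M≤m)
∈-interval⁺ M (suc j) M≤m m<M+1+j with m≤n⇒m<n∨m≡n M≤m
... | inj₂ refl = here refl
... | inj₁ M<m  = there (∈-interval⁺ (suc M) j M<m (≤-trans m<M+1+j (≤-reflexive (+-suc M j))))

-- (M+1)² + 4M³ ≤ 4M(M+1)² is what makes the bound 4N/M² survive the step from M+1 down to M.
sum-interval-inverse-cube : ∀ N (a : ℕ → ℕ) → (∀ m .{{_ : NonZero m}} → a m * m ^ 3 ≤ N) →
                            ∀ j M → sum (map a (interval M j)) * M ^ 2 ≤ 4 * N
sum-interval-inverse-cube N a a≤N/m³ zero    M       = z≤n
sum-interval-inverse-cube N a a≤N/m³ (suc j) zero    = ≤-trans (≤-reflexive (*-zeroʳ (sum (map a (interval 0 (suc j)))))) z≤n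
sum-interval-inverse-cube N a a≤N/m³ (suc j) (suc k) =
  *-cancelʳ-≤ ((x + y) * M ^ 2) (4 * N) (M * M′ ^ 2) (begin
    (x + y) * M ^ 2 * (M * M′ ^ 2)         ≡⟨ expand x y M M′ ⟩
    x * M ^ 3 * M′ ^ 2 + y * M′ ^ 2 * M ^ 3 ≤⟨ +-mono-≤ (*-monoˡ-≤ (M′ ^ 2) (a≤N/m³ M))
                                                         (*-monoˡ-≤ (M ^ 3) tail) ⟩
    N * M′ ^ 2 + 4 * N * M ^ 3             ≤⟨ ≤-reflexive (factor N M M′) ⟩
    N * (M′ ^ 2 + 4 * M ^ 3)               ≤⟨ *-monoʳ-≤ N (≤-trans (m≤m+n _ (7 * k * k + 16 * k + 8)) (≤-reflexive (key k))) ⟩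
    N * (4 * (M * M′ ^ 2))                 ≡⟨ swap N 4 _ ⟩
    4 * N * (M * M′ ^ 2)                   ∎)
  where
  open ≤-Reasoning
  M  = suc k
  M′ = suc M
  x  = a M
  y  = sum (map a (interval M′ j))
  tail : y * M′ ^ 2 ≤ 4 * N
  tail = sum-interval-inverse-cube N a a≤N/m³ j M′
  -- Stated with products: the ring solver does not interpret _^_.
  expand : ∀ a b m m′ → (a + b) * (m * (m * 1)) * (m * (m′ * (m′ * 1)))
                         ≡ a * (m * (m * (m * 1))) * (m′ * (m′ * 1)) + b * (m′ * (m′ * 1)) * (m * (m * (m * 1)))
  expand = solve-∀
  factor : ∀ n m m′ → n * (m′ * (m′ * 1)) + 4 * n * (m * (m * (m * 1)))
                       ≡ n * (m′ * (m′ * 1) + 4 * (m * (m * (m * 1))))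
  factor = solve-∀
  swap : ∀ a b c → a * (b * c) ≡ b * a * c
  swap = solve-∀
  key : ∀ k → (2 + k) * ((2 + k) * 1) + 4 * ((1 + k) * ((1 + k) * ((1 + k) * 1))) + (7 * k * k + 16 * k + 8)
              ≡ 4 * ((1 + k) * ((2 + k) * ((2 + k) * 1)))
  key = solve-∀

valAux-∣ : ∀ p B k → p ^ valAux p B k ∣ B
valAux-∣ p B zero    = 1∣ B
valAux-∣ p B (suc k) with (p ^ suc k) ∣? B
... | yes p^[1+k]∣B = p^[1+k]∣B
... | no  _         = valAux-∣ p B k

valAux-maximal : ∀ p B j k → p ^ j ∣ B → j ≤ k → j ≤ valAux p B k
valAux-maximal p B zero    k       _     _   = z≤n
valAux-maximal p B (suc j) (suc k) p^j∣B j≤k with (p ^ suc k) ∣? B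
... | yes _         = j≤k
... | no  p^[1+k]∤B with m≤n⇒m<n∨m≡n j≤k
...   | inj₂ refl = contradiction p^j∣B p^[1+k]∤B
...   | inj₁ j<k  = valAux-maximal p B (suc j) k p^j∣B (≤-pred j<k)

3≤v : ∀ p B .{{_ : NonZero B}} → Prime p → p ^ 3 ∣ B → 3 ≤ v p B
3≤v p B pp p³∣B = valAux-maximal p B 3 B p³∣B (≤-trans 3≤p³ (∣⇒≤ p³∣B))
  where
  3≤p³ : 3 ≤ p ^ 3
  3≤p³ = ≤-trans (s≤s (s≤s (s≤s z≤n))) (^-monoˡ-≤ 3 (nonTrivial⇒n>1 p {{prime⇒nonTrivial pp}}))

cubePrimes : ℕ → List ℕ
cubePrimes B = filter (λ p → prime? p ×-dec ((p ^ 3) ∣? B)) (range1 B)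

cubeRoot : ℕ → ℕ
cubeRoot B = product (map (λ p → p ^ (v p B / 3)) (cubePrimes B))

cubePrimes-prime∧∣ : ∀ B → All (λ p → Prime p × p ^ 3 ∣ B) (cubePrimes B)
cubePrimes-prime∧∣ B = all-filter (λ p → prime? p ×-dec ((p ^ 3) ∣? B)) (range1 B)

cubePrimes-unique : ∀ B → Unique (cubePrimes B)
cubePrimes-unique B = filter⁺ (λ p → prime? p ×-dec ((p ^ 3) ∣? B)) (map⁺ suc-injective (upTo⁺ B))

cubeRoot-^ : ∀ B n → cubeRoot B ^ n ≡ product (map (λ p → p ^ (v p B / 3 * n)) (cubePrimes B))
cubeRoot-^ B n = trans (product-map-^ _ (cubePrimes B) n)
                       (cong product (map-cong (λ p → ^-*-assoc p (v p B / 3) n) (cubePrimes B)))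

cubeRoot³∣ : ∀ B → cubeRoot B ^ 3 ∣ B
cubeRoot³∣ B = subst (_∣ B) (sym (cubeRoot-^ B 3))
  (primePowers-∣ B (λ p → v p B / 3 * 3) (cubePrimes-unique B)
    (All.map (λ { {p} (pp , _) → pp , ∣-trans (^-monoʳ-∣ p (m/n*n≤m (v p B) 3)) (valAux-∣ p B B) })
             (cubePrimes-prime∧∣ B)))

cubefullPart≤cubeRoot⁵ : ∀ B .{{_ : NonZero B}} → cubefullPart B ≤ cubeRoot B ^ 5
cubefullPart≤cubeRoot⁵ B = subst (cubefullPart B ≤_) (sym (cubeRoot-^ B 5))
  (product-map-mono-≤ _ _ (cubePrimes-prime∧∣ B)
    (λ { {p} (pp , p³∣B) → ^-monoʳ-≤ p {{prime⇒nonZero pp}} (m≤[m/3]*5 (v p B) (3≤v p B pp p³∣B)) }))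

large⇒cube-divisor : ∀ {K M N B} → (∀ m → K ≤ m ^ 5 → M ≤ m) → B ∈ range1 N → K ≤ cubefullPart B →
                     ∃[ m ] m ∈ interval M (suc N) × m ^ 3 ∣ B
large⇒cube-divisor {K} {M} {N} least B∈ K≤part with ∈-map⁻ suc B∈
... | b , b<N , refl = m , ∈-interval⁺ M (suc N) M≤m m<M+1+N , cubeRoot³∣ (suc b)
  where
  m = cubeRoot (suc b)
  M≤m : M ≤ m
  M≤m = least m (≤-trans K≤part (cubefullPart≤cubeRoot⁵ (suc b)))
  m≤N : m ≤ N
  m≤N = ≤-trans (∣⇒≤ (∣-trans (m∣m*n (m ^ 2)) (cubeRoot³∣ (suc b)))) (∈-upTo⁻ b<N)
  m<M+1+N : m < M + suc N
  m<M+1+N = subst (m <_) (sym (+-suc M N)) (s≤s (≤-trans m≤N (m≤n+m N M)))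

countLarge*M²≤4N : ∀ K N M → (∀ m → K ≤ m ^ 5 → M ≤ m) → countLarge K N * M ^ 2 ≤ 4 * N
countLarge*M²≤4N K N M least = ≤-trans
  (*-monoˡ-≤ (M ^ 2) (count≤sum-count (λ B → K ≤? cubefullPart B) (λ m → (m ^ 3) ∣?_)
                                      (interval M (suc N)) (range1 N) (large⇒cube-divisor least)))
  (sum-interval-inverse-cube N (λ m → count ((m ^ 3) ∣?_) (range1 N))
                             (λ m → count-multiples (m ^ 3) {{m^n≢0 m 3}} N) (suc N) M)

lemma5p4 : ∃ λ (C : ℕ) → ∀ (K N : ℕ) → 1 ≤ K → K ≤ N →
    (countLarge K N) ^ 5 * K ^ 2 ≤ C * N ^ 5
lemma5p4 = 4 ^ 5 , λ K N _ _ → bound K N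
  where
  bound : ∀ K N → countLarge K N ^ 5 * K ^ 2 ≤ 4 ^ 5 * N ^ 5
  bound K N with least-root 5 K
  ... | M , K≤M⁵ , least = begin
    c ^ 5 * K ^ 2           ≤⟨ *-monoʳ-≤ (c ^ 5) (^-monoˡ-≤ 2 K≤M⁵) ⟩
    c ^ 5 * (M ^ 5) ^ 2     ≡⟨ cong (c ^ 5 *_) (trans (^-*-assoc M 5 2) (sym (^-*-assoc M 2 5))) ⟩
    c ^ 5 * (M ^ 2) ^ 5     ≡⟨ ^-distribʳ-* c (M ^ 2) 5 ⟨
    (c * M ^ 2) ^ 5         ≤⟨ ^-monoˡ-≤ 5 (countLarge*M²≤4N K N M least) ⟩
    (4 * N) ^ 5             ≡⟨ ^-distribʳ-* 4 N 5 ⟩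
    4 ^ 5 * N ^ 5           ∎
    where
    open ≤-Reasoning
    c = countLarge K N
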